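{- Let $i,j\ge0$ and $m,n\ge1$. Let $\alpha\in\mathfrak{B}_{i+m}$ and $\beta\in\mathfrak{B}_{j+n}$ be signed permutations with $\alpha_k<0$ for $k\le i$, $\beta_k<0$ for $k\le j$, and write $\sigma=\alpha_{i+1}\cdots\alpha_{i+m}$, $\tau=\beta_{j+1}\cdots\beta_{j+n}$, assuming $\sigma_1=\alpha_{i+1}>0$ and $\tau_1=\beta_{j+1}>0$ (so $\alpha=(\smile^i,\sigma)$, $\beta=(\smile^j,\tau)$). Then $$\varphi_2(\alpha\overline{\star}_{ -1}\beta)=\varphi_2(\mathrm{st}(\sigma)\overline{\star}_{ -1}\mathrm{st}(\tau)).$$
   Context: $\mathfrak{B}_n$ is the set of permutations $\pi$ of $\{ -n,\dots,n\}$ with $\pi(-i)=-\pi(i)$, written as words $\pi_1\cdots\pi_n$, $\mathfrak{B}_0=\{\imath\}$; $\mathfrak{S}_n$ those with all entries positive. $\mathrm{st}$ of a word $a_1\cdots a_n$ over $\mathbb{Z}\setminus\{0\}$ is the unique $b_1\cdots b_n\in\mathfrak{B}_n$ with $\mathrm{sign}(b_i)=\mathrm{sign}(a_i)$ and $|b_i|<|b_j|$ whenever $|a_i|<|a_j|$ or ($|a_i|=|a_j|$, $i<j$), extended linearly. On words over $\mathbb{Z}\setminus\{0\}$, $\star_{ -1}$ is the bilinear product with the empty word as identity and $au\star_{ -1}bv=a(u\star_{ -1}bv)+b(au\star_{ -1}v)-(a\bullet b)(u\star_{ -1}v)$, where $a\bullet b=a$ if $a,b<0$ and $0$ otherwise.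 For $\sigma\in\mathfrak{B}_m,\tau\in\mathfrak{B}_n$, $\sigma\overline{\star}_{ -1}\tau=\mathrm{st}(\sigma\star_{ -1}\tau[m])$, where $\tau[m]$ replaces positive letters $i$ by $i+m$ and negative letters $-i$ by $-(i+m)$. The linear map $\varphi_2:\bigoplus_n\mathbf{k}\mathfrak{B}_n\to\bigoplus_n\mathbf{k}\mathfrak{S}_n$ is defined on $\pi\in\mathfrak{B}_n$ by $\varphi_2(\pi)=(-1)^j\mathrm{st}(\bar\pi)$ if there are $i\ge0$, $j\in\{0,1\}$ with $i+j<n$ such that $\pi_k<0$ for $k\le i$ and for $k>n-j$, and $\pi_k>0$ for $i<k\le n-j$ ($\bar\pi$ being the subword of positive entries), and $\varphi_2(\pi)=\delta_{\pi,\imath}$ otherwise. -}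

module Defs where

open import Data.Bool using (Bool; true; false; if_then_else_; _∧_; _∨_; not; T)
open import Data.Nat as ℕ using (ℕ; zero; suc; _<ᵇ_; _≡ᵇ_; _≤ᵇ_)
open import Data.Integer as ℤ using (ℤ; +_; -[1+_]; +[1+_]; ∣_∣)
open import Data.Product using (_×_; _,_)
open import Data.Maybe using (Maybe; just; nothing)
open import Data.List using (List; []; _∷_; _++_; map; length; upTo; zip; concatMap)
open import Data.List.Properties using (≡-dec)
open import Data.List.Relation.Binary.Permutation.Propositional using (_↭_)
open import Data.Empty using (⊥)
open import Relation.Nullary using (does)

-- Letters are nonzero integers; words are lists of integers.

isPos : ℤ → Bool
isPos +[1+ _ ] = true
isPos _        = false

isNeg : ℤ → Bool
isNeg -[1+ _ ] = true
isNeg _        = false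

IsSignedPerm : ℕ → List ℤ → Set
IsSignedPerm n w = map ∣_∣ w ↭ map suc (upTo n)

FirstPos : List ℤ → Set
FirstPos []      = ⊥
FirstPos (a ∷ _) = T (isPos a)

indexed : List ℤ → List (ℕ × ℤ)
indexed w = zip (upTo (length w)) w

countBelow : ℕ → ℤ → List (ℕ × ℤ) → ℕ
countBelow i a [] = 0
countBelow i a ((j , b) ∷ r) =
  (if (∣ b ∣ <ᵇ ∣ a ∣) ∨ ((∣ b ∣ ≡ᵇ ∣ a ∣) ∧ (j <ᵇ i)) then 1 else 0)
    ℕ.+ countBelow i a r

withSign : ℤ → ℕ → ℤ
withSign a r = if isNeg a then ℤ.- (+ r) else + r

st : List ℤ → List ℤ
st w = map (λ { (i , a) → withSign a (suc (countBelow i a (indexed w))) }) (indexed w)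

-- Formal ℤ-linear combinations of words

LC : Set
LC = List (ℤ × List ℤ)

coeff : LC → List ℤ → ℤ
coeff [] w = + 0
coeff ((c , u) ∷ r) w =
  (if does (≡-dec ℤ._≟_ u w) then c else + 0) ℤ.+ coeff r w

extend : (List ℤ → LC) → LC → LC
extend f = concatMap (λ { (c , u) → map (λ { (d , v) → (c ℤ.* d , v) }) (f u) })

stL : LC → LC
stL = extend (λ u → (+ 1 , st u) ∷ [])

prefix : ℤ → LC → LC
prefix a = map (λ { (c , u) → (c , a ∷ u) })

scale : ℤ → LC → LC
scale d = map (λ { (c , u) → (d ℤ.* c , u) })

infixl 6 _⋆_
_⋆_ : List ℤ → List ℤ → LC
[] ⋆ v = (+ 1 , v) ∷ []
(a ∷ u) ⋆ [] = (+ 1 , a ∷ u) ∷ []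
(a ∷ u) ⋆ (b ∷ v) =
  prefix a (u ⋆ (b ∷ v)) ++ prefix b ((a ∷ u) ⋆ v)
    ++ (if isNeg a ∧ isNeg b then scale (ℤ.- (+ 1)) (prefix a (u ⋆ v)) else [])

shiftL : ℕ → ℤ → ℤ
shiftL m (+ k)      = + (k ℕ.+ m)
shiftL m -[1+ k ]   = -[1+ k ℕ.+ m ]

shift : ℕ → List ℤ → List ℤ
shift m = map (shiftL m)

_⋆̄_ : List ℤ → List ℤ → LC
σ ⋆̄ τ = stL (σ ⋆ shift (length σ) τ)

positives : List ℤ → List ℤ
positives [] = []
positives (a ∷ w) = if isPos a then a ∷ positives w else positives w

-- position k (1-based) of π ∈ 𝔅_n satisfies the sign condition for (i , j)
condAt : ℕ → ℕ → ℕ → ℕ → ℤ → Bool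
condAt n i j k a =
  if (k ≤ᵇ i) ∨ ((n ℕ.∸ j) <ᵇ k) then isNeg a else isPos a

allB : List Bool → Bool
allB [] = true
allB (b ∷ bs) = b ∧ allB bs

Cond : List ℤ → ℕ → ℕ → Bool
Cond π i j =
  ((i ℕ.+ j) <ᵇ length π)
    ∧ allB (map (λ { (k , a) → condAt (length π) i j (suc k) a }) (indexed π))

findJ : List ℤ → List ℕ → Maybe ℕ
findJ π [] = nothing
findJ π (i ∷ is) =
  if Cond π i 0 then just 0 else
  (if Cond π i 1 then just 1 else findJ π is)

sgn : ℕ → ℤ
sgn zero    = + 1
sgn (suc _) = ℤ.- (+ 1)

φ₂ : List ℤ → LC
φ₂ π with findJ π (upTo (suc (length π)))
... | just j  = (sgn j , st (positives π)) ∷ []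
... | nothing with π
...   | []    = (+ 1 , []) ∷ []
...   | _ ∷ _ = []

φ₂L : LC → LC
φ₂L = extend φ₂

-- Both sides are sums  Σ c · weight w u  over the words u of a ⋆-product, where weight w u is
-- the coefficient of w in φ₂ (st u). For a word u with distinct nonzero letters, φ₂ (st u) only
-- depends on the sign pattern of u and on st of its positive letters; hence it vanishes when a
-- positive letter is followed by a negative and then by a positive letter, and it is unchanged by
-- deleting a negative first letter. Expanding (P σ) ⋆ (Q τ[N]) along the negative prefixes P and Q
-- with the recursion of ⋆, the terms that put a letter of σ (or τ) in front of a remaining letter
-- of Q (or P) vanish, the leading negative letters are deleted, and the correction term of two
-- negative letters cancels one of the two resulting copies: what remains is σ ⋆ τ[N]. Finally the
-- relabelling of letters by their rank in σ τ[N] carries σ ⋆ τ[N] to st σ ⋆ (st τ)[m] without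
-- changing the standardization of any word.

module Submission where

open import Defs
open import Data.Bool using (Bool; true; false; T; if_then_else_; _∧_)
open import Data.Bool.Properties using (T-∧)
open import Data.Empty using (⊥; ⊥-elim)
open import Data.Integer as ℤ using (ℤ; +_; -[1+_]; +[1+_]; ∣_∣; NonZero)
import Data.Integer.Properties as ℤ
open import Data.List using (List; []; _∷_; _++_; map; length; take; drop; upTo; applyUpTo; zip)
open import Data.List.Properties
  using (≡-dec; map-∘; map-cong; map-cong-local; map-++; length-map; length-upTo; map-applyUpTo; take++drop≡id)
open import Data.List.Membership.Propositional using (_∈_; _∉_)
open import Data.List.Membership.Propositional.Properties using (∈-map⁺; ∈-map⁻; ∈-++⁻; ∈-upTo⁻)
open import Data.List.Relation.Binary.Disjoint.Propositional using (Disjoint; contractₗ; contractᵣ)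
open import Data.List.Relation.Binary.Permutation.Propositional using (↭-sym; ↭⇒↭ₛ)
open import Data.List.Relation.Binary.Permutation.Propositional.Properties using (∈-resp-↭; ↭-length)
open import Data.List.Relation.Binary.Pointwise using (Pointwise; []; _∷_; Pointwise-length)
open import Data.List.Relation.Binary.Subset.Propositional using (_⊆_)
open import Data.List.Relation.Binary.Subset.Propositional.Properties
  using (⊆-refl; ⊆-trans; ∷⁺ʳ; ∈-∷⁺ʳ; xs⊆x∷xs; xs⊆xs++ys)
import Data.List.Relation.Binary.Subset.Propositional.Properties as Subset
open import Data.List.Relation.Unary.All using (All; []; _∷_)
import Data.List.Relation.Unary.All as All
import Data.List.Relation.Unary.All.Properties as All
open import Data.List.Relation.Unary.AllPairs using ([]; _∷_)
open import Data.List.Relation.Unary.Any using (Any; here; there)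
import Data.List.Relation.Unary.Any.Properties as Any
open import Data.List.Relation.Unary.Unique.Propositional using (Unique)
import Data.List.Relation.Unary.Unique.Propositional.Properties as Unique
open import Data.Maybe using (Maybe; just; nothing)
open import Data.Nat as ℕ using (ℕ; suc; zero; _+_; _∸_; _≥_; _<_; _≤_; _<ᵇ_; _≤ᵇ_; _≡ᵇ_; z≤n; s≤s)
import Data.Nat.Properties as ℕ
open import Data.Product using (_×_; _,_; proj₁; proj₂; ∃₂; map₂)
open import Data.Sum using (_⊎_; inj₁; inj₂; [_,_])
open import Data.Unit using (tt)
open import Function using (id; _∘_; Equivalence)
open import Relation.Binary.Definitions using (tri<; tri≈; tri>)
open import Relation.Binary.PropositionalEquality
  using (_≡_; _≢_; refl; sym; trans; cong; cong₂; subst; setoid; module ≡-Reasoning)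
open import Data.List.Relation.Binary.Permutation.Setoid.Properties (setoid ℕ) using (Unique-resp-↭)
open import Relation.Nullary using (¬_; does)

open ≡-Reasoning

T-ext : ∀ {x y} → (T x → T y) → (T y → T x) → x ≡ y
T-ext {false} {false} _ _ = refl
T-ext {false} {true}  _ g = ⊥-elim (g tt)
T-ext {true}  {false} f _ = ⊥-elim (f tt)
T-ext {true}  {true}  _ _ = refl

<ᵇ-true : ∀ {m n} → m < n → (m <ᵇ n) ≡ true
<ᵇ-true m<n = T-ext (λ _ → tt) (λ _ → ℕ.<⇒<ᵇ m<n)

<ᵇ-false : ∀ {m n} → n ≤ m → (m <ᵇ n) ≡ false
<ᵇ-false {m} {n} n≤m = T-ext (λ t → ℕ.<⇒≱ (ℕ.<ᵇ⇒< m n t) n≤m) λ ()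

≡ᵇ-true : ∀ {m n} → m ≡ n → (m ≡ᵇ n) ≡ true
≡ᵇ-true {m} {n} m≡n = T-ext (λ _ → tt) (λ _ → ℕ.≡⇒≡ᵇ m n m≡n)

≡ᵇ-false : ∀ {m n} → m ≢ n → (m ≡ᵇ n) ≡ false
≡ᵇ-false {m} {n} m≢n = T-ext (λ t → m≢n (ℕ.≡ᵇ⇒≡ m n t)) λ ()

<ᵇ-≡ᵇ-preserved : ∀ m n {m′ n′} → (m < n → m′ < n′) → (m ≡ n → m′ ≡ n′) → (n < m → n′ < m′)
  → (m <ᵇ n) ≡ (m′ <ᵇ n′) × (m ≡ᵇ n) ≡ (m′ ≡ᵇ n′)
<ᵇ-≡ᵇ-preserved m n lt eq gt with ℕ.<-cmp m n
... | tri< m<n m≢n _ =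
  trans (<ᵇ-true m<n) (sym (<ᵇ-true (lt m<n))) , trans (≡ᵇ-false m≢n) (sym (≡ᵇ-false (ℕ.<⇒≢ (lt m<n))))
... | tri≈ _ m≡n _ =
  trans (<ᵇ-false (ℕ.≤-reflexive (sym m≡n))) (sym (<ᵇ-false (ℕ.≤-reflexive (sym (eq m≡n))))) ,
  trans (≡ᵇ-true m≡n) (sym (≡ᵇ-true (eq m≡n)))
... | tri> _ m≢n n<m =
  trans (<ᵇ-false (ℕ.<⇒≤ n<m)) (sym (<ᵇ-false (ℕ.<⇒≤ (gt n<m)))) ,
  trans (≡ᵇ-false m≢n) (sym (≡ᵇ-false (ℕ.>⇒≢ (gt n<m))))

-- Linear combinations of words

linear : (List ℤ → ℤ) → LC → ℤ
linear H []            = + 0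
linear H ((c , u) ∷ L) = c ℤ.* H u ℤ.+ linear H L

AllWords : (List ℤ → Set) → LC → Set
AllWords P = All (λ e → P (proj₂ e))

linear-++ : ∀ H L L′ → linear H (L ++ L′) ≡ linear H L ℤ.+ linear H L′
linear-++ H []            L′ = sym (ℤ.+-identityˡ _)
linear-++ H ((c , u) ∷ L) L′ =
  trans (cong (ℤ._+_ (c ℤ.* H u)) (linear-++ H L L′)) (sym (ℤ.+-assoc (c ℤ.* H u) _ _))

linear-prefix : ∀ H a L → linear H (prefix a L) ≡ linear (λ u → H (a ∷ u)) L
linear-prefix H a []            = refl
linear-prefix H a ((c , u) ∷ L) = cong (ℤ._+_ (c ℤ.* H (a ∷ u))) (linear-prefix H a L)

linear-scale : ∀ H d L → linear H (scale d L) ≡ d ℤ.* linear H L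
linear-scale H d []            = sym (ℤ.*-zeroʳ d)
linear-scale H d ((c , u) ∷ L) =
  trans (cong₂ ℤ._+_ (ℤ.*-assoc d c (H u)) (linear-scale H d L)) (sym (ℤ.*-distribˡ-+ d _ _))

linear-cong : ∀ {H H′} L → AllWords (λ u → H u ≡ H′ u) L → linear H L ≡ linear H′ L
linear-cong []            []       = refl
linear-cong ((c , u) ∷ L) (e ∷ es) = cong₂ ℤ._+_ (cong (c ℤ.*_) e) (linear-cong L es)

linear-zero : ∀ {H} L → AllWords (λ u → H u ≡ + 0) L → linear H L ≡ + 0
linear-zero []            []       = refl
linear-zero ((c , u) ∷ L) (e ∷ es) =
  cong₂ ℤ._+_ (trans (cong (c ℤ.*_) e) (ℤ.*-zeroʳ c)) (linear-zero L es)

coeff-++ : ∀ L L′ w → coeff (L ++ L′) w ≡ coeff L w ℤ.+ coeff L′ w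
coeff-++ []            L′ w = sym (ℤ.+-identityˡ _)
coeff-++ ((c , u) ∷ L) L′ w =
  trans (cong (ℤ._+_ δ) (coeff-++ L L′ w)) (sym (ℤ.+-assoc δ (coeff L w) (coeff L′ w)))
  where
  δ : ℤ
  δ = if does (≡-dec ℤ._≟_ u w) then c else + 0

coeff-rescale : ∀ c L w → coeff (map (λ { (d , v) → (c ℤ.* d , v) }) L) w ≡ c ℤ.* coeff L w
coeff-rescale c []            w = sym (ℤ.*-zeroʳ c)
coeff-rescale c ((d , v) ∷ L) w =
  trans (cong₂ ℤ._+_ (if-rescale (does (≡-dec ℤ._≟_ v w))) (coeff-rescale c L w)) (sym (ℤ.*-distribˡ-+ c _ _))
  where
  if-rescale : ∀ b → (if b then c ℤ.* d else + 0) ≡ c ℤ.* (if b then d else + 0)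
  if-rescale true  = refl
  if-rescale false = sym (ℤ.*-zeroʳ c)

coeff-extend : ∀ f L w → coeff (extend f L) w ≡ linear (λ u → coeff (f u) w) L
coeff-extend f []            w = refl
coeff-extend f ((c , u) ∷ L) w = begin
  coeff (map (λ { (d , v) → (c ℤ.* d , v) }) (f u) ++ extend f L) w
    ≡⟨ coeff-++ (map (λ { (d , v) → (c ℤ.* d , v) }) (f u)) (extend f L) w ⟩
  coeff (map (λ { (d , v) → (c ℤ.* d , v) }) (f u)) w ℤ.+ coeff (extend f L) w
    ≡⟨ cong₂ ℤ._+_ (coeff-rescale c (f u) w) (coeff-extend f L w) ⟩
  c ℤ.* coeff (f u) w ℤ.+ linear (λ u → coeff (f u) w) L ∎

linear-stL : ∀ H L → linear H (stL L) ≡ linear (H ∘ st) L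
linear-stL H []            = refl
linear-stL H ((c , u) ∷ L) = cong₂ ℤ._+_ (cong (ℤ._* H (st u)) (ℤ.*-identityʳ c)) (linear-stL H L)

weight : List ℤ → List ℤ → ℤ
weight w u = coeff (φ₂ (st u)) w

coeff-φ₂L-⋆̄ : ∀ σ τ w → coeff (φ₂L (σ ⋆̄ τ)) w ≡ linear (weight w) (σ ⋆ shift (length σ) τ)
coeff-φ₂L-⋆̄ σ τ w =
  trans (coeff-extend φ₂ (σ ⋆̄ τ) w) (linear-stL (λ u → coeff (φ₂ u) w) (σ ⋆ shift (length σ) τ))

linear-correction : ∀ H b L → linear H (if b then scale (ℤ.- (+ 1)) L else []) ≡ (if b then ℤ.- linear H L else + 0)
linear-correction H true  L = trans (linear-scale H (ℤ.- (+ 1)) L) (ℤ.-1*i≡-i (linear H L))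
linear-correction H false L = refl

linear-⋆-∷ : ∀ H a u b v → linear H ((a ∷ u) ⋆ (b ∷ v))
  ≡ linear H (prefix a (u ⋆ (b ∷ v))) ℤ.+ linear H (prefix b ((a ∷ u) ⋆ v))
    ℤ.+ (if isNeg a ∧ isNeg b then ℤ.- linear H (prefix a (u ⋆ v)) else + 0)
linear-⋆-∷ H a u b v = begin
  linear H (X ++ Y ++ Z)                       ≡⟨ linear-++ H X (Y ++ Z) ⟩
  linear H X ℤ.+ linear H (Y ++ Z)             ≡⟨ cong (ℤ._+_ (linear H X)) (linear-++ H Y Z) ⟩
  linear H X ℤ.+ (linear H Y ℤ.+ linear H Z)   ≡⟨ ℤ.+-assoc (linear H X) _ _ ⟨
  linear H X ℤ.+ linear H Y ℤ.+ linear H Z     ≡⟨ cong (ℤ._+_ (linear H X ℤ.+ linear H Y)) (linear-correction H _ (prefix a (u ⋆ v))) ⟩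
  linear H X ℤ.+ linear H Y ℤ.+ (if isNeg a ∧ isNeg b then ℤ.- linear H (prefix a (u ⋆ v)) else + 0) ∎
  where
  X = prefix a (u ⋆ (b ∷ v))
  Y = prefix b ((a ∷ u) ⋆ v)
  Z = if isNeg a ∧ isNeg b then scale (ℤ.- (+ 1)) (prefix a (u ⋆ v)) else []

-- Standardization

indexedBy : (ℕ → ℕ) → List ℤ → List (ℕ × ℤ)
indexedBy f []      = []
indexedBy f (a ∷ u) = (f 0 , a) ∷ indexedBy (f ∘ suc) u

zip-applyUpTo : ∀ f u → zip (applyUpTo f (length u)) u ≡ indexedBy f u
zip-applyUpTo f []      = refl
zip-applyUpTo f (a ∷ u) = cong ((f 0 , a) ∷_) (zip-applyUpTo (f ∘ suc) u)

map-proj₂-indexedBy : ∀ f u → map proj₂ (indexedBy f u) ≡ u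
map-proj₂-indexedBy f []      = refl
map-proj₂-indexedBy f (a ∷ u) = cong (a ∷_) (map-proj₂-indexedBy (f ∘ suc) u)

length-indexedBy : ∀ f u → length (indexedBy f u) ≡ length u
length-indexedBy f []      = refl
length-indexedBy f (a ∷ u) = cong suc (length-indexedBy (f ∘ suc) u)

indexedBy-map : ∀ f g u → indexedBy f (map g u) ≡ map (map₂ g) (indexedBy f u)
indexedBy-map f g []      = refl
indexedBy-map f g (a ∷ u) = cong ((f 0 , g a) ∷_) (indexedBy-map (f ∘ suc) g u)

∈-indexedBy : ∀ {f u e} → e ∈ indexedBy f u → proj₂ e ∈ u
∈-indexedBy {f} {u} e∈ = subst (_ ∈_) (map-proj₂-indexedBy f u) (∈-map⁺ proj₂ e∈)

stEntry : List (ℕ × ℤ) → ℕ × ℤ → ℤ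
stEntry L (i , a) = withSign a (suc (countBelow i a L))

st-indexedBy : ∀ w → st w ≡ map (stEntry (indexedBy id w)) (indexedBy id w)
st-indexedBy w = cong (λ L → map (stEntry L) L) (zip-applyUpTo id w)

length-st : ∀ u → length (st u) ≡ length u
length-st u = trans (cong length (st-indexedBy u)) (trans (length-map _ (indexedBy id u)) (length-indexedBy id u))

PreservesAbsOrder : (ℤ → ℤ) → ℤ → ℤ → Set
PreservesAbsOrder f a b = (∣ b ∣ <ᵇ ∣ a ∣) ≡ (∣ f b ∣ <ᵇ ∣ f a ∣) × (∣ b ∣ ≡ᵇ ∣ a ∣) ≡ (∣ f b ∣ ≡ᵇ ∣ f a ∣)

countBelow-relabel : ∀ f i a L → All (λ e → PreservesAbsOrder f a (proj₂ e)) L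
  → countBelow i (f a) (map (map₂ f) L) ≡ countBelow i a L
countBelow-relabel f i a []            []              = refl
countBelow-relabel f i a ((j , b) ∷ L) ((<-eq , ≡-eq) ∷ ps) rewrite <-eq | ≡-eq =
  cong (_+_ _) (countBelow-relabel f i a L ps)

withSign-cong : ∀ {a b} r → isNeg a ≡ isNeg b → withSign a r ≡ withSign b r
withSign-cong r e = cong (λ s → if s then ℤ.- (+ r) else + r) e

st-relabel : ∀ f u → (∀ a → isNeg (f a) ≡ isNeg a) → (∀ {a b} → a ∈ u → b ∈ u → PreservesAbsOrder f a b)
  → st (map f u) ≡ st u
st-relabel f u f-sign f-order = begin
  st (map f u)                                          ≡⟨ st-indexedBy (map f u) ⟩
  map (stEntry (indexedBy id (map f u))) (indexedBy id (map f u))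
                                                        ≡⟨ cong (λ M → map (stEntry M) M) (indexedBy-map id f u) ⟩
  map (stEntry (map (map₂ f) L)) (map (map₂ f) L)       ≡⟨ map-∘ L ⟨
  map (stEntry (map (map₂ f) L) ∘ map₂ f) L             ≡⟨ map-cong-local (All.tabulate entry) ⟩
  map (stEntry L) L                                     ≡⟨ st-indexedBy u ⟨
  st u ∎
  where
  L = indexedBy id u
  entry : ∀ {e} → e ∈ L → stEntry (map (map₂ f) L) (map₂ f e) ≡ stEntry L e
  entry {i , a} e∈ = trans (withSign-cong _ (f-sign a)) (cong (λ c → withSign a (suc c))
    (countBelow-relabel f i a L (All.tabulate λ e′∈ → f-order (∈-indexedBy e∈) (∈-indexedBy e′∈))))

countSmaller : ℤ → List ℤ → ℕ
countSmaller a []      = 0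
countSmaller a (b ∷ u) = (if ∣ b ∣ <ᵇ ∣ a ∣ then 1 else 0) + countSmaller a u

rank : List ℤ → ℤ → ℤ
rank X a = withSign a (suc (countSmaller a X))

Unique-map⇒injective : ∀ {A : Set} (h : A → ℕ) {L} → Unique (map h L) → ∀ {e e′} → e ∈ L → e′ ∈ L → h e′ ≡ h e → e′ ≡ e
Unique-map⇒injective h (_ ∷ _)        (here refl) (here refl) _ = refl
Unique-map⇒injective h (fresh ∷ _)    (here refl) (there e′∈) eq = ⊥-elim (All.lookup fresh (∈-map⁺ h e′∈) (sym eq))
Unique-map⇒injective h (fresh ∷ _)    (there e∈)  (here refl) eq = ⊥-elim (All.lookup fresh (∈-map⁺ h e∈) eq)
Unique-map⇒injective h (_ ∷ unique)   (there e∈)  (there e′∈) eq = Unique-map⇒injective h unique e∈ e′∈ eq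

countBelow-noTies : ∀ i a L → All (λ e → ((∣ proj₂ e ∣ ≡ᵇ ∣ a ∣) ∧ (proj₁ e <ᵇ i)) ≡ false) L
  → countBelow i a L ≡ countSmaller a (map proj₂ L)
countBelow-noTies i a []            []       = refl
countBelow-noTies i a ((j , b) ∷ L) (t ∷ ts) with ∣ b ∣ <ᵇ ∣ a ∣
... | true                 = cong suc (countBelow-noTies i a L ts)
... | false rewrite t      = countBelow-noTies i a L ts

st≡map-rank : ∀ x → Unique (map ∣_∣ x) → st x ≡ map (rank x) x
st≡map-rank x unique = begin
  st x                               ≡⟨ st-indexedBy x ⟩
  map (stEntry L) L                  ≡⟨ map-cong-local (All.tabulate entry) ⟩
  map (rank x ∘ proj₂) L             ≡⟨ map-∘ L ⟩
  map (rank x) (map proj₂ L)         ≡⟨ cong (map (rank x)) (map-proj₂-indexedBy id x) ⟩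
  map (rank x) x ∎
  where
  L = indexedBy id x
  unique-L : Unique (map (∣_∣ ∘ proj₂) L)
  unique-L = subst Unique (trans (cong (map ∣_∣) (sym (map-proj₂-indexedBy id x))) (sym (map-∘ L))) unique
  noTie : ∀ {i a} → (i , a) ∈ L → ∀ {e} → e ∈ L → ((∣ proj₂ e ∣ ≡ᵇ ∣ a ∣) ∧ (proj₁ e <ᵇ i)) ≡ false
  noTie {i} {a} e∈ {j , b} e′∈ with ∣ b ∣ ≡ᵇ ∣ a ∣ in tie
  ... | false = refl
  ... | true with Unique-map⇒injective (∣_∣ ∘ proj₂) unique-L e∈ e′∈ (ℕ.≡ᵇ⇒≡ _ _ (subst T (sym tie) tt))
  ...   | refl = <ᵇ-false {i} ℕ.≤-refl
  entry : ∀ {e} → e ∈ L → stEntry L e ≡ rank x (proj₂ e)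
  entry {i , a} e∈ = cong (λ c → withSign a (suc c))
    (trans (countBelow-noTies i a L (All.tabulate (noTie e∈))) (cong (countSmaller a) (map-proj₂-indexedBy id x)))

∣withSign∣ : ∀ a r → ∣ withSign a (suc r) ∣ ≡ suc r
∣withSign∣ a r with isNeg a
... | true  = refl
... | false = refl

isNeg-withSign : ∀ a r → isNeg (withSign a (suc r)) ≡ isNeg a
isNeg-withSign a r with isNeg a
... | true  = refl
... | false = refl

smaller-mono : ∀ c a b → ∣ b ∣ ≤ ∣ a ∣ → (if ∣ c ∣ <ᵇ ∣ b ∣ then 1 else 0) ≤ (if ∣ c ∣ <ᵇ ∣ a ∣ then 1 else 0)
smaller-mono c a b b≤a with ∣ c ∣ <ᵇ ∣ b ∣ in c<b
... | false = z≤n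
... | true rewrite <ᵇ-true (ℕ.<-≤-trans (ℕ.<ᵇ⇒< ∣ c ∣ ∣ b ∣ (subst T (sym c<b) tt)) b≤a) = ℕ.≤-refl

countSmaller-mono : ∀ X {a b} → ∣ b ∣ ≤ ∣ a ∣ → countSmaller b X ≤ countSmaller a X
countSmaller-mono []      b≤a = z≤n
countSmaller-mono (c ∷ X) {a} {b} b≤a = ℕ.+-mono-≤ (smaller-mono c a b b≤a) (countSmaller-mono X b≤a)

countSmaller-strict : ∀ X {a b} → b ∈ X → ∣ b ∣ < ∣ a ∣ → countSmaller b X < countSmaller a X
countSmaller-strict (c ∷ X) {a} {b} (here refl) b<a rewrite <ᵇ-false {∣ b ∣} (ℕ.≤-refl {∣ b ∣}) | <ᵇ-true b<a =
  s≤s (countSmaller-mono X (ℕ.<⇒≤ b<a))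
countSmaller-strict (c ∷ X) {a} {b} (there b∈) b<a =
  ℕ.+-mono-≤-< (smaller-mono c a b (ℕ.<⇒≤ b<a)) (countSmaller-strict X b∈ b<a)

countSmaller-cong : ∀ X {a b} → ∣ b ∣ ≡ ∣ a ∣ → countSmaller b X ≡ countSmaller a X
countSmaller-cong X b≡a =
  ℕ.≤-antisym (countSmaller-mono X (ℕ.≤-reflexive b≡a)) (countSmaller-mono X (ℕ.≤-reflexive (sym b≡a)))

rank-preservesAbsOrder : ∀ X {a b} → a ∈ X → b ∈ X → PreservesAbsOrder (rank X) a b
rank-preservesAbsOrder X {a} {b} a∈ b∈ rewrite ∣withSign∣ a (countSmaller a X) | ∣withSign∣ b (countSmaller b X) =
  <ᵇ-≡ᵇ-preserved ∣ b ∣ ∣ a ∣ (s≤s ∘ countSmaller-strict X b∈) (cong suc ∘ countSmaller-cong X)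
    (s≤s ∘ countSmaller-strict X a∈)

Distinct : List ℤ → Set
Distinct u = All NonZero u × Unique (map ∣_∣ u)

isPos-rank : ∀ X a → NonZero a → isPos (rank X a) ≡ isPos a
isPos-rank X +[1+ n ] _ = refl
isPos-rank X -[1+ n ] _ = refl

positives-map-rank : ∀ X v → All NonZero v → positives (map (rank X) v) ≡ map (rank X) (positives v)
positives-map-rank X []      []         = refl
positives-map-rank X (a ∷ v) (a≠0 ∷ v≠0) rewrite isPos-rank X a a≠0 with isPos a
... | true  = cong (rank X a ∷_) (positives-map-rank X v v≠0)
... | false = positives-map-rank X v v≠0

positives-⊆ : ∀ v → positives v ⊆ v
positives-⊆ (b ∷ v) p with isPos b
positives-⊆ (b ∷ v) (here refl) | true  = here refl
positives-⊆ (b ∷ v) (there p)   | true  = there (positives-⊆ v p)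
positives-⊆ (b ∷ v) p           | false = there (positives-⊆ v p)

st-positives-st : ∀ x → Distinct x → st (positives (st x)) ≡ st (positives x)
st-positives-st x (x≠0 , unique) = begin
  st (positives (st x))             ≡⟨ cong (st ∘ positives) (st≡map-rank x unique) ⟩
  st (positives (map (rank x) x))   ≡⟨ cong st (positives-map-rank x x x≠0) ⟩
  st (map (rank x) (positives x))   ≡⟨ st-relabel (rank x) (positives x) (λ a → isNeg-withSign a (countSmaller a x))
                                         (λ a∈ b∈ → rank-preservesAbsOrder x (positives-⊆ x a∈) (positives-⊆ x b∈)) ⟩
  st (positives x) ∎

-- φ₂ sees only the sign pattern and the positive letters

SameSign : ℤ → ℤ → Set
SameSign a b = isNeg a ≡ isNeg b × isPos a ≡ isPos b

sameSign-withSign : ∀ a r → NonZero a → SameSign a (withSign a (suc r))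
sameSign-withSign +[1+ n ] r _ = refl , refl
sameSign-withSign -[1+ n ] r _ = refl , refl

st-sameSigns : ∀ u → All NonZero u → Pointwise SameSign u (st u)
st-sameSigns u u≠0 = subst (Pointwise SameSign u) (sym (st-indexedBy u)) (entrywise id u u≠0)
  where
  entrywise : ∀ f v → All NonZero v → Pointwise SameSign v (map (stEntry (indexedBy id u)) (indexedBy f v))
  entrywise f []      []          = []
  entrywise f (a ∷ v) (a≠0 ∷ v≠0) = sameSign-withSign a _ a≠0 ∷ entrywise (f ∘ suc) v v≠0

condEntry : ℕ → ℕ → ℕ → ℕ × ℤ → Bool
condEntry n i j (k , a) = condAt n i j (suc k) a

Admissible : ℕ → ℕ → ℕ → (ℕ → ℕ) → List ℤ → Bool
Admissible n i j f u = allB (map (condEntry n i j) (indexedBy f u))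

Cond≡Admissible : ∀ u i j → Cond u i j ≡ ((i + j) <ᵇ length u) ∧ Admissible (length u) i j id u
Cond≡Admissible u i j = cong (λ L → ((i + j) <ᵇ length u) ∧ allB (map (condEntry (length u) i j) L)) (zip-applyUpTo id u)

Admissible-sameSigns : ∀ n i j f {u v} → Pointwise SameSign u v → Admissible n i j f u ≡ Admissible n i j f v
Admissible-sameSigns n i j f []                       = refl
Admissible-sameSigns n i j f ((neg≡ , pos≡) ∷ signs) =
  cong₂ _∧_ (cong₂ (if_then_else_ _) neg≡ pos≡) (Admissible-sameSigns n i j (f ∘ suc) signs)

Cond-sameSigns : ∀ {u v} → Pointwise SameSign u v → ∀ i j → Cond u i j ≡ Cond v i j
Cond-sameSigns {u} {v} signs i j rewrite Cond≡Admissible u i j | Cond≡Admissible v i j | Pointwise-length signs =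
  cong (_ ∧_) (Admissible-sameSigns _ i j id signs)

findJ-sameSigns : ∀ {u v} → Pointwise SameSign u v → ∀ is → findJ u is ≡ findJ v is
findJ-sameSigns signs []       = refl
findJ-sameSigns signs (i ∷ is) rewrite Cond-sameSigns signs i 0 | Cond-sameSigns signs i 1 | findJ-sameSigns signs is = refl

φ₂-cases : Maybe ℕ → List ℤ → ℕ → LC
φ₂-cases (just j) s _       = (sgn j , s) ∷ []
φ₂-cases nothing  _ zero    = (+ 1 , []) ∷ []
φ₂-cases nothing  _ (suc _) = []

φ₂≡φ₂-cases : ∀ v → φ₂ v ≡ φ₂-cases (findJ v (upTo (suc (length v)))) (st (positives v)) (length v)
φ₂≡φ₂-cases v with findJ v (upTo (suc (length v)))
... | just j  = refl
... | nothing with v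
...   | []    = refl
...   | _ ∷ _ = refl

φ₂-st : ∀ u → Distinct u → φ₂ (st u) ≡ φ₂-cases (findJ u (upTo (suc (length u)))) (st (positives u)) (length u)
φ₂-st u d@(u≠0 , _) = begin
  φ₂ (st u)
    ≡⟨ φ₂≡φ₂-cases (st u) ⟩
  φ₂-cases (findJ (st u) (upTo (suc (length (st u))))) (st (positives (st u))) (length (st u))
    ≡⟨ cong (λ n → φ₂-cases (findJ (st u) (upTo (suc n))) (st (positives (st u))) n) (length-st u) ⟩
  φ₂-cases (findJ (st u) (upTo (suc (length u)))) (st (positives (st u))) (length u)
    ≡⟨ cong₂ (λ m s → φ₂-cases m s (length u)) (sym (findJ-sameSigns (st-sameSigns u u≠0) (upTo (suc (length u))))) (st-positives-st u d) ⟩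
  φ₂-cases (findJ u (upTo (suc (length u)))) (st (positives u)) (length u) ∎

Admissible-shift : ∀ n i j f v → (∀ m → ((suc n ∸ j) <ᵇ suc m) ≡ ((n ∸ j) <ᵇ m))
  → Admissible (suc n) (suc i) j (suc ∘ f) v ≡ Admissible n i j f v
Admissible-shift n i j f []      _   = refl
Admissible-shift n i j f (a ∷ v) n∸j rewrite n∸j (suc (f 0)) = cong (_ ∧_) (Admissible-shift n i j (f ∘ suc) v n∸j)

Cond-dropNeg : ∀ k b u i j → j ≤ 1 → Cond (-[1+ k ] ∷ b ∷ u) (suc i) j ≡ Cond (b ∷ u) i j
Cond-dropNeg k b u i j j≤1 rewrite Cond≡Admissible (-[1+ k ] ∷ b ∷ u) (suc i) j | Cond≡Admissible (b ∷ u) i j =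
  cong (((i + j) <ᵇ suc (length u)) ∧_) (Admissible-shift (suc (length u)) i j id (b ∷ u) (∸-suc j≤1))
  where
  ∸-suc : ∀ {j} → j ≤ 1 → ∀ m → ((suc (suc (length u)) ∸ j) <ᵇ suc m) ≡ ((suc (length u) ∸ j) <ᵇ m)
  ∸-suc z≤n       m = refl
  ∸-suc (s≤s z≤n) m = refl

findJ-dropNeg : ∀ k b u is → findJ (-[1+ k ] ∷ b ∷ u) (map suc is) ≡ findJ (b ∷ u) is
findJ-dropNeg k b u []       = refl
findJ-dropNeg k b u (i ∷ is)
  rewrite Cond-dropNeg k b u i 0 z≤n | Cond-dropNeg k b u i 1 (s≤s z≤n) | findJ-dropNeg k b u is = refl

-- The candidate i = 0 fails for a word with a negative first letter, so the longer search
-- is the shorter one shifted by one.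
findJ-upTo-dropNeg : ∀ k b u
  → findJ (-[1+ k ] ∷ b ∷ u) (upTo (suc (length (-[1+ k ] ∷ b ∷ u)))) ≡ findJ (b ∷ u) (upTo (suc (length (b ∷ u))))
findJ-upTo-dropNeg k b u =
  trans (cong (findJ (-[1+ k ] ∷ b ∷ u)) (sym (map-applyUpTo id suc (suc (suc (length u))))))
        (findJ-dropNeg k b u (upTo (suc (suc (length u)))))

IsPos : ℤ → Set
IsPos a = T (isPos a)

IsNeg : ℤ → Set
IsNeg a = T (isNeg a)

data NegThenPos : List ℤ → Set where
  here  : ∀ {a u} → IsNeg a → Any IsPos u → NegThenPos (a ∷ u)
  there : ∀ {a u} → NegThenPos u → NegThenPos (a ∷ u)

data PosNegPos : List ℤ → Set where
  here  : ∀ {a u} → IsPos a → NegThenPos u → PosNegPos (a ∷ u)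
  there : ∀ {a u} → PosNegPos u → PosNegPos (a ∷ u)

condAt-pos : ∀ n i j p a → IsPos a → T (condAt n i j p a) → i < p × p ≤ n ∸ j
condAt-pos n i j p +[1+ m ] _ t with p ≤ᵇ i in p≤i | (n ∸ j) <ᵇ p in n∸j<p
... | false | false = ℕ.≰⇒> (λ le → subst T p≤i (ℕ.≤⇒≤ᵇ le)) , ℕ.≮⇒≥ (λ lt → subst T n∸j<p (ℕ.<⇒<ᵇ lt))

condAt-neg : ∀ n i j p a → IsNeg a → T (condAt n i j p a) → p ≤ i ⊎ n ∸ j < p
condAt-neg n i j p -[1+ m ] _ t with p ≤ᵇ i in p≤i | (n ∸ j) <ᵇ p in n∸j<p
... | true  | _    = inj₁ (ℕ.≤ᵇ⇒≤ p i (subst T (sym p≤i) tt))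
... | false | true = inj₂ (ℕ.<ᵇ⇒< (n ∸ j) p (subst T (sym n∸j<p) tt))

Increasing : (ℕ → ℕ) → Set
Increasing f = ∀ k → f k < f (suc k)

-- In an admissible word the positive letters occupy exactly the positions i+1, …, n-j.
module _ (n i j : ℕ) where

  private
    uncons : ∀ f a u → T (Admissible n i j f (a ∷ u)) → T (condAt n i j (suc (f 0)) a) × T (Admissible n i j (f ∘ suc) u)
    uncons f a u = Equivalence.to T-∧

  pos-bound : ∀ f u → Increasing f → Any IsPos u → T (Admissible n i j f u) → suc (f 0) ≤ n ∸ j
  pos-bound f (a ∷ u) inc (here a>0) t = proj₂ (condAt-pos n i j _ a a>0 (proj₁ (uncons f a u t)))
  pos-bound f (a ∷ u) inc (there p)  t = ℕ.≤-trans (inc 0) (ℕ.<⇒≤ (pos-bound (f ∘ suc) u (inc ∘ suc) p (proj₂ (uncons f a u t))))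

  neg-bound : ∀ f u → Increasing f → NegThenPos u → T (Admissible n i j f u) → suc (f 0) ≤ i
  neg-bound f (a ∷ u) inc (here a<0 p) t with condAt-neg n i j _ a a<0 (proj₁ (uncons f a u t))
  ... | inj₁ le = le
  ... | inj₂ gt = ⊥-elim (ℕ.<⇒≱ gt (ℕ.≤-trans (inc 0) (ℕ.<⇒≤ (pos-bound (f ∘ suc) u (inc ∘ suc) p (proj₂ (uncons f a u t))))))
  neg-bound f (a ∷ u) inc (there p) t = ℕ.≤-trans (inc 0) (ℕ.<⇒≤ (neg-bound (f ∘ suc) u (inc ∘ suc) p (proj₂ (uncons f a u t))))

  posNegPos-inadmissible : ∀ f u → Increasing f → PosNegPos u → ¬ T (Admissible n i j f u)
  posNegPos-inadmissible f (a ∷ u) inc (here a>0 p) t =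
    ℕ.<⇒≱ (proj₁ (condAt-pos n i j _ a a>0 (proj₁ (uncons f a u t))))
          (ℕ.≤-trans (inc 0) (ℕ.<⇒≤ (neg-bound (f ∘ suc) u (inc ∘ suc) p (proj₂ (uncons f a u t)))))
  posNegPos-inadmissible f (a ∷ u) inc (there p) t = posNegPos-inadmissible (f ∘ suc) u (inc ∘ suc) p (proj₂ (uncons f a u t))

Cond-posNegPos : ∀ {u} → PosNegPos u → ∀ i j → Cond u i j ≡ false
Cond-posNegPos {u} p i j rewrite Cond≡Admissible u i j =
  T-ext (λ t → posNegPos-inadmissible (length u) i j id u (λ _ → ℕ.≤-refl) p (proj₂ (Equivalence.to T-∧ t))) λ ()

findJ-posNegPos : ∀ {u} → PosNegPos u → ∀ is → findJ u is ≡ nothing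
findJ-posNegPos p []       = refl
findJ-posNegPos p (i ∷ is) rewrite Cond-posNegPos p i 0 | Cond-posNegPos p i 1 = findJ-posNegPos p is

Distinct-tail : ∀ {a u} → Distinct (a ∷ u) → Distinct u
Distinct-tail (_ ∷ u≠0 , _ ∷ unique) = u≠0 , unique

weight-posNegPos : ∀ w {u} → Distinct u → PosNegPos u → weight w u ≡ + 0
weight-posNegPos w {a ∷ u} d p = cong (λ L → coeff L w)
  (trans (φ₂-st (a ∷ u) d) (cong (λ m → φ₂-cases m (st (positives (a ∷ u))) (suc (length u))) (findJ-posNegPos p (upTo (2 + length u)))))

φ₂-cases-nonempty : ∀ m s n n′ → φ₂-cases m s (suc n) ≡ φ₂-cases m s (suc n′)
φ₂-cases-nonempty (just j) s n n′ = refl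
φ₂-cases-nonempty nothing  s n n′ = refl

weight-dropNeg : ∀ w {k t} → Distinct (-[1+ k ] ∷ t) → Any IsPos t → weight w (-[1+ k ] ∷ t) ≡ weight w t
weight-dropNeg w {k} {b ∷ u} d _ = cong (λ L → coeff L w) (begin
  φ₂ (st (-[1+ k ] ∷ b ∷ u))
    ≡⟨ φ₂-st (-[1+ k ] ∷ b ∷ u) d ⟩
  φ₂-cases (findJ (-[1+ k ] ∷ b ∷ u) (upTo (3 + length u))) s (2 + length u)
    ≡⟨ cong (λ m → φ₂-cases m s (2 + length u)) (findJ-upTo-dropNeg k b u) ⟩
  φ₂-cases (findJ (b ∷ u) (upTo (2 + length u))) s (2 + length u)
    ≡⟨ φ₂-cases-nonempty _ s _ (length u) ⟩
  φ₂-cases (findJ (b ∷ u) (upTo (2 + length u))) s (1 + length u)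
    ≡⟨ φ₂-st (b ∷ u) (Distinct-tail d) ⟨
  φ₂ (st (b ∷ u)) ∎)
  where
  s = st (positives (b ∷ u))

-- The words of a ⋆-product

AllWords-correction⁺ : ∀ {P : List ℤ → Set} a b L → (IsNeg a → IsNeg b → AllWords (P ∘ (a ∷_)) L)
  → AllWords P (if isNeg a ∧ isNeg b then scale (ℤ.- (+ 1)) (prefix a L) else [])
AllWords-correction⁺ (+ _)    _        L _ = []
AllWords-correction⁺ -[1+ _ ] (+ _)    L _ = []
AllWords-correction⁺ -[1+ _ ] -[1+ _ ] L p = All.map⁺ (All.map⁺ (p tt tt))

AllWords-correction⁻ : ∀ {P : List ℤ → Set} a b L → AllWords P (if isNeg a ∧ isNeg b then scale (ℤ.- (+ 1)) (prefix a L) else [])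
  → IsNeg a → IsNeg b → AllWords (P ∘ (a ∷_)) L
AllWords-correction⁻ -[1+ _ ] -[1+ _ ] L p _ _ = All.map⁻ (All.map⁻ p)

AllWords-⋆⁺ : ∀ {P : List ℤ → Set} a u b v
  → AllWords (P ∘ (a ∷_)) (u ⋆ (b ∷ v)) → AllWords (P ∘ (b ∷_)) ((a ∷ u) ⋆ v)
  → (IsNeg a → IsNeg b → AllWords (P ∘ (a ∷_)) (u ⋆ v))
  → AllWords P ((a ∷ u) ⋆ (b ∷ v))
AllWords-⋆⁺ a u b v p q r = All.++⁺ (All.map⁺ p) (All.++⁺ (All.map⁺ q) (AllWords-correction⁺ a b (u ⋆ v) r))

AllWords-⋆⁻ : ∀ {P : List ℤ → Set} a u b v → AllWords P ((a ∷ u) ⋆ (b ∷ v))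
  → AllWords (P ∘ (a ∷_)) (u ⋆ (b ∷ v)) × AllWords (P ∘ (b ∷_)) ((a ∷ u) ⋆ v)
    × (IsNeg a → IsNeg b → AllWords (P ∘ (a ∷_)) (u ⋆ v))
AllWords-⋆⁻ a u b v p with All.++⁻ (prefix a (u ⋆ (b ∷ v))) p
... | p₁ , p₂₃ with All.++⁻ (prefix b ((a ∷ u) ⋆ v)) p₂₃
...   | p₂ , p₃ = All.map⁻ p₁ , All.map⁻ p₂ , AllWords-correction⁻ a b (u ⋆ v) p₃

IsPos∧IsNeg⇒⊥ : ∀ {a} → IsPos a → IsNeg a → ⊥
IsPos∧IsNeg⇒⊥ {+ _}      _ ()
IsPos∧IsNeg⇒⊥ { -[1+ _ ] } () _

⋆-Any-IsPosʳ : ∀ U V → Any IsPos V → AllWords (Any IsPos) (U ⋆ V)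
⋆-Any-IsPosʳ []      V       p = p ∷ []
⋆-Any-IsPosʳ (a ∷ u) (b ∷ v) p = AllWords-⋆⁺ a u b v (All.map there (⋆-Any-IsPosʳ u (b ∷ v) p)) (second p) (third p)
  where
  second : Any IsPos (b ∷ v) → AllWords (Any IsPos ∘ (b ∷_)) ((a ∷ u) ⋆ v)
  second (here b>0) = All.universal (λ _ → here b>0) _
  second (there p)  = All.map there (⋆-Any-IsPosʳ (a ∷ u) v p)
  third : Any IsPos (b ∷ v) → IsNeg a → IsNeg b → AllWords (Any IsPos ∘ (a ∷_)) (u ⋆ v)
  third (here b>0) _ b<0 = ⊥-elim (IsPos∧IsNeg⇒⊥ b>0 b<0)
  third (there p)  _ _   = All.map there (⋆-Any-IsPosʳ u v p)

⋆-Any-IsPosˡ : ∀ U V → Any IsPos U → AllWords (Any IsPos) (U ⋆ V)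
⋆-Any-IsPosˡ (a ∷ u) []      p = p ∷ []
⋆-Any-IsPosˡ (a ∷ u) (b ∷ v) p = AllWords-⋆⁺ a u b v (first p) (All.map there (⋆-Any-IsPosˡ (a ∷ u) v p)) (third p)
  where
  first : Any IsPos (a ∷ u) → AllWords (Any IsPos ∘ (a ∷_)) (u ⋆ (b ∷ v))
  first (here a>0) = All.universal (λ _ → here a>0) _
  first (there p)  = All.map there (⋆-Any-IsPosˡ u (b ∷ v) p)
  third : Any IsPos (a ∷ u) → IsNeg a → IsNeg b → AllWords (Any IsPos ∘ (a ∷_)) (u ⋆ v)
  third (here a>0) a<0 _ = ⊥-elim (IsPos∧IsNeg⇒⊥ a>0 a<0)
  third (there p)  _   _ = All.map there (⋆-Any-IsPosˡ u v p)

⋆-NegThenPosʳ : ∀ U V → NegThenPos V → AllWords NegThenPos (U ⋆ V)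
⋆-NegThenPosʳ []      V       p = p ∷ []
⋆-NegThenPosʳ (a ∷ u) (b ∷ v) p = AllWords-⋆⁺ a u b v (All.map there (⋆-NegThenPosʳ u (b ∷ v) p)) (second p) (third p)
  where
  second : NegThenPos (b ∷ v) → AllWords (NegThenPos ∘ (b ∷_)) ((a ∷ u) ⋆ v)
  second (here b<0 q) = All.map (here b<0) (⋆-Any-IsPosʳ (a ∷ u) v q)
  second (there p)    = All.map there (⋆-NegThenPosʳ (a ∷ u) v p)
  third : NegThenPos (b ∷ v) → IsNeg a → IsNeg b → AllWords (NegThenPos ∘ (a ∷_)) (u ⋆ v)
  third (here _ q) a<0 _ = All.map (here a<0) (⋆-Any-IsPosʳ u v q)
  third (there p)  _   _ = All.map there (⋆-NegThenPosʳ u v p)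

⋆-NegThenPosˡ : ∀ U V → NegThenPos U → AllWords NegThenPos (U ⋆ V)
⋆-NegThenPosˡ (a ∷ u) []      p = p ∷ []
⋆-NegThenPosˡ (a ∷ u) (b ∷ v) p = AllWords-⋆⁺ a u b v (first p) (All.map there (⋆-NegThenPosˡ (a ∷ u) v p)) (third p)
  where
  first : NegThenPos (a ∷ u) → AllWords (NegThenPos ∘ (a ∷_)) (u ⋆ (b ∷ v))
  first (here a<0 q) = All.map (here a<0) (⋆-Any-IsPosˡ u (b ∷ v) q)
  first (there p)    = All.map there (⋆-NegThenPosˡ u (b ∷ v) p)
  third : NegThenPos (a ∷ u) → IsNeg a → IsNeg b → AllWords (NegThenPos ∘ (a ∷_)) (u ⋆ v)
  third (here a<0 q) _ _ = All.map (here a<0) (⋆-Any-IsPosˡ u v q)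
  third (there p)    _ _ = All.map there (⋆-NegThenPosˡ u v p)

⋆-⊆ : ∀ U V → AllWords (_⊆ U ++ V) (U ⋆ V)
⋆-⊆ []      V       = ⊆-refl ∷ []
⋆-⊆ (a ∷ u) []      = xs⊆xs++ys (a ∷ u) [] ∷ []
⋆-⊆ (a ∷ u) (b ∷ v) = AllWords-⋆⁺ a u b v
  (All.map keep-a (⋆-⊆ u (b ∷ v))) (All.map keep-b (⋆-⊆ (a ∷ u) v)) (λ _ _ → All.map merge (⋆-⊆ u v))
  where
  drop-b : ∀ {xs} → xs ++ v ⊆ xs ++ b ∷ v
  drop-b {xs} = Subset.++⁺ʳ xs (xs⊆x∷xs v b)
  keep-a : ∀ {t} → t ⊆ u ++ b ∷ v → a ∷ t ⊆ (a ∷ u) ++ b ∷ v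
  keep-a = ∷⁺ʳ a
  keep-b : ∀ {t} → t ⊆ (a ∷ u) ++ v → b ∷ t ⊆ (a ∷ u) ++ b ∷ v
  keep-b t⊆ = ∈-∷⁺ʳ (Any.++⁺ʳ (a ∷ u) (here refl)) (⊆-trans t⊆ drop-b)
  merge : ∀ {t} → t ⊆ u ++ v → a ∷ t ⊆ (a ∷ u) ++ b ∷ v
  merge t⊆ = ∷⁺ʳ a (⊆-trans t⊆ drop-b)

Distinct-∷ : ∀ {a t X} → NonZero a → ∣ a ∣ ∉ map ∣_∣ X → t ⊆ X → Distinct t → Distinct (a ∷ t)
Distinct-∷ {t = t} a≠0 a∉X t⊆X (t≠0 , unique) =
  a≠0 ∷ t≠0 , All.¬Any⇒All¬ (map ∣_∣ t) (a∉X ∘ Subset.map⁺ ∣_∣ t⊆X) ∷ unique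

AllWords-Distinct-∷ : ∀ {a X} L → NonZero a → ∣ a ∣ ∉ map ∣_∣ X
  → AllWords Distinct L → AllWords (_⊆ X) L → AllWords (Distinct ∘ (a ∷_)) L
AllWords-Distinct-∷ []      a≠0 a∉X []       []           = []
AllWords-Distinct-∷ (_ ∷ L) a≠0 a∉X (d ∷ ds) (t⊆X ∷ subs) =
  Distinct-∷ a≠0 a∉X t⊆X d ∷ AllWords-Distinct-∷ L a≠0 a∉X ds subs

∉-map-++ : ∀ {n} X Y → n ∉ map ∣_∣ X → n ∉ map ∣_∣ Y → n ∉ map ∣_∣ (X ++ Y)
∉-map-++ X Y n∉X n∉Y n∈ = [ n∉X , n∉Y ] (∈-++⁻ (map ∣_∣ X) (subst (_ ∈_) (map-++ ∣_∣ X Y) n∈))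

⋆-Distinct : ∀ U V → Distinct U → Distinct V → Disjoint (map ∣_∣ U) (map ∣_∣ V) → AllWords Distinct (U ⋆ V)
⋆-Distinct []      V       _  dV _ = dV ∷ []
⋆-Distinct (a ∷ u) []      dU _  _ = dU ∷ []
⋆-Distinct (a ∷ u) (b ∷ v) dU@(a≠0 ∷ _ , _) dV@(b≠0 ∷ _ , _) disjoint = AllWords-⋆⁺ a u b v
  (AllWords-Distinct-∷ (u ⋆ (b ∷ v)) a≠0 (∉-map-++ u (b ∷ v) a∉u a∉bv)
    (⋆-Distinct u (b ∷ v) (Distinct-tail dU) dV (contractₗ disjoint)) (⋆-⊆ u (b ∷ v)))
  (AllWords-Distinct-∷ ((a ∷ u) ⋆ v) b≠0 (∉-map-++ (a ∷ u) v b∉au b∉v)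
    (⋆-Distinct (a ∷ u) v dU (Distinct-tail dV) (contractᵣ disjoint)) (⋆-⊆ (a ∷ u) v))
  (λ _ _ → AllWords-Distinct-∷ (u ⋆ v) a≠0 (∉-map-++ u v a∉u (a∉bv ∘ there))
    (⋆-Distinct u v (Distinct-tail dU) (Distinct-tail dV) (contractₗ (contractᵣ disjoint))) (⋆-⊆ u v))
  where
  a∉u : ∣ a ∣ ∉ map ∣_∣ u
  a∉u = Unique.Unique[x∷xs]⇒x∉xs (proj₂ dU)
  b∉v : ∣ b ∣ ∉ map ∣_∣ v
  b∉v = Unique.Unique[x∷xs]⇒x∉xs (proj₂ dV)
  a∉bv : ∣ a ∣ ∉ map ∣_∣ (b ∷ v)
  a∉bv p = disjoint (here refl , p)
  b∉au : ∣ b ∣ ∉ map ∣_∣ (a ∷ u)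
  b∉au p = disjoint (p , here refl)

-- Dropping the negative prefixes

s+s-s≡s : ∀ s → s ℤ.+ s ℤ.+ ℤ.- s ≡ s
s+s-s≡s s = trans (ℤ.+-assoc s s (ℤ.- s)) (trans (cong (ℤ._+_ s) (ℤ.+-inverseʳ s)) (ℤ.+-identityʳ s))

module NegativePrefixes
  (H : List ℤ → ℤ)
  (H-dropNeg : ∀ {k t} → Distinct (-[1+ k ] ∷ t) → Any IsPos t → H (-[1+ k ] ∷ t) ≡ H t)
  (H-posNegPos : ∀ {t} → Distinct t → PosNegPos t → H t ≡ + 0)
  where

  linear-prefixNeg : ∀ k L → AllWords (Distinct ∘ (-[1+ k ] ∷_)) L → AllWords (Any IsPos) L
    → linear H (prefix -[1+ k ] L) ≡ linear H L
  linear-prefixNeg k L ds ps = trans (linear-prefix H -[1+ k ] L) (linear-cong L (termwise L ds ps))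
    where
    termwise : ∀ L → AllWords (Distinct ∘ (-[1+ k ] ∷_)) L → AllWords (Any IsPos) L
      → AllWords (λ t → H (-[1+ k ] ∷ t) ≡ H t) L
    termwise []      []       []       = []
    termwise (_ ∷ L) (d ∷ ds) (p ∷ ps) = H-dropNeg d p ∷ termwise L ds ps

  linear-prefixPos : ∀ k L → AllWords (Distinct ∘ (+[1+ k ] ∷_)) L → AllWords NegThenPos L
    → linear H (prefix +[1+ k ] L) ≡ + 0
  linear-prefixPos k L ds ps = trans (linear-prefix H +[1+ k ] L) (linear-zero L (termwise L ds ps))
    where
    termwise : ∀ L → AllWords (Distinct ∘ (+[1+ k ] ∷_)) L → AllWords NegThenPos L
      → AllWords (λ t → H (+[1+ k ] ∷ t) ≡ + 0) L
    termwise []      []       []       = []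
    termwise (_ ∷ L) (d ∷ ds) (p ∷ ps) = H-posNegPos d (here tt p) ∷ termwise L ds ps

  module _ (ka : ℕ) (x : List ℤ) (kb : ℕ) (y : List ℤ) where

    private
      σ τ : List ℤ
      σ = +[1+ ka ] ∷ x
      τ = +[1+ kb ] ∷ y

    linear-⋆-negPrefixes : ∀ P Q → All IsNeg P → All IsNeg Q → Distinct (P ++ σ) → Distinct (Q ++ τ)
      → Disjoint (map ∣_∣ (P ++ σ)) (map ∣_∣ (Q ++ τ))
      → linear H ((P ++ σ) ⋆ (Q ++ τ)) ≡ linear H (σ ⋆ τ)
    linear-⋆-negPrefixes [] [] _ _ _ _ _ = refl
    linear-⋆-negPrefixes [] (+ _ ∷ Q) _ (() ∷ _)
    linear-⋆-negPrefixes (+ _ ∷ P) Q (() ∷ _)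
    linear-⋆-negPrefixes [] (-[1+ kq ] ∷ Q) [] (_ ∷ Q<0) dσ dQτ disjoint = begin
      linear H (σ ⋆ (q ∷ Q ++ τ))
        ≡⟨ linear-⋆-∷ H +[1+ ka ] x q (Q ++ τ) ⟩
      linear H (prefix +[1+ ka ] (x ⋆ (q ∷ Q ++ τ))) ℤ.+ linear H (prefix q (σ ⋆ (Q ++ τ))) ℤ.+ + 0
        ≡⟨ cong₂ (λ s t → s ℤ.+ t ℤ.+ + 0)
             (linear-prefixPos ka _ D₁ (⋆-NegThenPosʳ x (q ∷ Q ++ τ) (here tt (Any.++⁺ʳ Q (here tt)))))
             (linear-prefixNeg kq _ D₂ (⋆-Any-IsPosˡ σ (Q ++ τ) (here tt))) ⟩
      + 0 ℤ.+ linear H (σ ⋆ (Q ++ τ)) ℤ.+ + 0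
        ≡⟨ trans (ℤ.+-identityʳ _) (ℤ.+-identityˡ _) ⟩
      linear H (σ ⋆ (Q ++ τ))
        ≡⟨ linear-⋆-negPrefixes [] Q [] Q<0 dσ (Distinct-tail dQτ) (contractᵣ disjoint) ⟩
      linear H (σ ⋆ τ) ∎
      where
      q = -[1+ kq ]
      D = AllWords-⋆⁻ +[1+ ka ] x q (Q ++ τ) (⋆-Distinct σ (q ∷ Q ++ τ) dσ dQτ disjoint)
      D₁ = proj₁ D
      D₂ = proj₁ (proj₂ D)
    linear-⋆-negPrefixes (-[1+ kp ] ∷ P) [] (_ ∷ P<0) [] dPσ dτ disjoint = begin
      linear H ((p ∷ P ++ σ) ⋆ τ)
        ≡⟨ linear-⋆-∷ H p (P ++ σ) +[1+ kb ] y ⟩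
      linear H (prefix p ((P ++ σ) ⋆ τ)) ℤ.+ linear H (prefix +[1+ kb ] ((p ∷ P ++ σ) ⋆ y)) ℤ.+ + 0
        ≡⟨ cong₂ (λ s t → s ℤ.+ t ℤ.+ + 0)
             (linear-prefixNeg kp _ D₁ (⋆-Any-IsPosʳ (P ++ σ) τ (here tt)))
             (linear-prefixPos kb _ D₂ (⋆-NegThenPosˡ (p ∷ P ++ σ) y (here tt (Any.++⁺ʳ P (here tt))))) ⟩
      linear H ((P ++ σ) ⋆ τ) ℤ.+ + 0 ℤ.+ + 0
        ≡⟨ trans (ℤ.+-identityʳ _) (ℤ.+-identityʳ _) ⟩
      linear H ((P ++ σ) ⋆ τ)
        ≡⟨ linear-⋆-negPrefixes P [] P<0 [] (Distinct-tail dPσ) dτ (contractₗ disjoint) ⟩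
      linear H (σ ⋆ τ) ∎
      where
      p = -[1+ kp ]
      D = AllWords-⋆⁻ p (P ++ σ) +[1+ kb ] y (⋆-Distinct (p ∷ P ++ σ) τ dPσ dτ disjoint)
      D₁ = proj₁ D
      D₂ = proj₁ (proj₂ D)
    linear-⋆-negPrefixes (-[1+ kp ] ∷ P) (-[1+ kq ] ∷ Q) (_ ∷ P<0) (_ ∷ Q<0) dPσ dQτ disjoint = begin
      linear H ((p ∷ P ++ σ) ⋆ (q ∷ Q ++ τ))
        ≡⟨ linear-⋆-∷ H p (P ++ σ) q (Q ++ τ) ⟩
      linear H (prefix p ((P ++ σ) ⋆ (q ∷ Q ++ τ))) ℤ.+ linear H (prefix q ((p ∷ P ++ σ) ⋆ (Q ++ τ)))
        ℤ.+ ℤ.- linear H (prefix p ((P ++ σ) ⋆ (Q ++ τ)))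
        ≡⟨ cong₂ (λ s t → s ℤ.+ t ℤ.+ ℤ.- linear H (prefix p ((P ++ σ) ⋆ (Q ++ τ))))
             (linear-prefixNeg kp _ D₁ (⋆-Any-IsPosˡ (P ++ σ) (q ∷ Q ++ τ) (σ∈ P)))
             (linear-prefixNeg kq _ D₂ (⋆-Any-IsPosˡ (p ∷ P ++ σ) (Q ++ τ) (there (σ∈ P)))) ⟩
      linear H ((P ++ σ) ⋆ (q ∷ Q ++ τ)) ℤ.+ linear H ((p ∷ P ++ σ) ⋆ (Q ++ τ))
        ℤ.+ ℤ.- linear H (prefix p ((P ++ σ) ⋆ (Q ++ τ)))
        ≡⟨ cong (ℤ._+_ S₁₂ ∘ ℤ.-_) (trans (linear-prefixNeg kp _ (D₃ tt tt) (⋆-Any-IsPosˡ (P ++ σ) (Q ++ τ) (σ∈ P)))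
             (linear-⋆-negPrefixes P Q P<0 Q<0 (Distinct-tail dPσ) (Distinct-tail dQτ) (contractₗ (contractᵣ disjoint)))) ⟩
      linear H ((P ++ σ) ⋆ (q ∷ Q ++ τ)) ℤ.+ linear H ((p ∷ P ++ σ) ⋆ (Q ++ τ))
        ℤ.+ ℤ.- linear H (σ ⋆ τ)
        ≡⟨ cong₂ (λ s t → s ℤ.+ t ℤ.+ ℤ.- linear H (σ ⋆ τ))
             (linear-⋆-negPrefixes P (-[1+ kq ] ∷ Q) P<0 (tt ∷ Q<0) (Distinct-tail dPσ) dQτ (contractₗ disjoint))
             (linear-⋆-negPrefixes (-[1+ kp ] ∷ P) Q (tt ∷ P<0) Q<0 dPσ (Distinct-tail dQτ) (contractᵣ disjoint)) ⟩
      linear H (σ ⋆ τ) ℤ.+ linear H (σ ⋆ τ) ℤ.+ ℤ.- linear H (σ ⋆ τ)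
        ≡⟨ s+s-s≡s (linear H (σ ⋆ τ)) ⟩
      linear H (σ ⋆ τ) ∎
      where
      p = -[1+ kp ]
      q = -[1+ kq ]
      S₁₂ = linear H ((P ++ σ) ⋆ (q ∷ Q ++ τ)) ℤ.+ linear H ((p ∷ P ++ σ) ⋆ (Q ++ τ))
      σ∈ : ∀ P → Any IsPos (P ++ σ)
      σ∈ P = Any.++⁺ʳ P (here tt)
      D = AllWords-⋆⁻ p (P ++ σ) q (Q ++ τ) (⋆-Distinct (p ∷ P ++ σ) (q ∷ Q ++ τ) dPσ dQτ disjoint)
      D₁ = proj₁ D
      D₂ = proj₁ (proj₂ D)
      D₃ = proj₂ (proj₂ D)

-- Relabelling the letters of a ⋆-product

relabel : (ℤ → ℤ) → LC → LC
relabel f = map (map₂ (map f))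

relabel-prefix : ∀ f a L → relabel f (prefix a L) ≡ prefix (f a) (relabel f L)
relabel-prefix f a []      = refl
relabel-prefix f a (_ ∷ L) = cong (_ ∷_) (relabel-prefix f a L)

relabel-scale : ∀ f d L → relabel f (scale d L) ≡ scale d (relabel f L)
relabel-scale f d []      = refl
relabel-scale f d (_ ∷ L) = cong (_ ∷_) (relabel-scale f d L)

relabel-if : ∀ f b L → relabel f (if b then L else []) ≡ (if b then relabel f L else [])
relabel-if f true  L = refl
relabel-if f false L = refl

⋆-relabel : ∀ f → (∀ a → isNeg (f a) ≡ isNeg a) → ∀ U V → map f U ⋆ map f V ≡ relabel f (U ⋆ V)
⋆-relabel f f-sign []      V       = refl
⋆-relabel f f-sign (a ∷ u) []      = refl
⋆-relabel f f-sign (a ∷ u) (b ∷ v) = sym (begin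
  relabel f (prefix a (u ⋆ (b ∷ v)) ++ prefix b ((a ∷ u) ⋆ v) ++ Z)
    ≡⟨ map-++ _ (prefix a (u ⋆ (b ∷ v))) _ ⟩
  relabel f (prefix a (u ⋆ (b ∷ v))) ++ relabel f (prefix b ((a ∷ u) ⋆ v) ++ Z)
    ≡⟨ cong (relabel f (prefix a (u ⋆ (b ∷ v))) ++_) (map-++ _ (prefix b ((a ∷ u) ⋆ v)) Z) ⟩
  relabel f (prefix a (u ⋆ (b ∷ v))) ++ relabel f (prefix b ((a ∷ u) ⋆ v)) ++ relabel f Z
    ≡⟨ cong₂ _++_ (trans (relabel-prefix f a _) (cong (prefix (f a)) (sym (⋆-relabel f f-sign u (b ∷ v)))))
         (cong₂ _++_ (trans (relabel-prefix f b _) (cong (prefix (f b)) (sym (⋆-relabel f f-sign (a ∷ u) v))))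
           correction) ⟩
  map f (a ∷ u) ⋆ map f (b ∷ v) ∎)
  where
  Z = if isNeg a ∧ isNeg b then scale (ℤ.- (+ 1)) (prefix a (u ⋆ v)) else []
  correction : relabel f Z ≡ (if isNeg (f a) ∧ isNeg (f b) then scale (ℤ.- (+ 1)) (prefix (f a) (map f u ⋆ map f v)) else [])
  correction = begin
    relabel f Z
      ≡⟨ relabel-if f (isNeg a ∧ isNeg b) _ ⟩
    (if isNeg a ∧ isNeg b then relabel f (scale (ℤ.- (+ 1)) (prefix a (u ⋆ v))) else [])
      ≡⟨ cong (λ L → if isNeg a ∧ isNeg b then L else [])
           (trans (relabel-scale f (ℤ.- (+ 1)) (prefix a (u ⋆ v))) (cong (scale (ℤ.- (+ 1))) (relabel-prefix f a (u ⋆ v)))) ⟩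
    (if isNeg a ∧ isNeg b then scale (ℤ.- (+ 1)) (prefix (f a) (relabel f (u ⋆ v))) else [])
      ≡⟨ cong₂ (λ c L → if c then scale (ℤ.- (+ 1)) (prefix (f a) L) else [])
           (sym (cong₂ _∧_ (f-sign a) (f-sign b))) (sym (⋆-relabel f f-sign u v)) ⟩
    (if isNeg (f a) ∧ isNeg (f b) then scale (ℤ.- (+ 1)) (prefix (f a) (map f u ⋆ map f v)) else []) ∎

linear-relabel : ∀ H f L → linear H (relabel f L) ≡ linear (H ∘ map f) L
linear-relabel H f []            = refl
linear-relabel H f ((c , u) ∷ L) = cong (ℤ._+_ (c ℤ.* H (map f u))) (linear-relabel H f L)

∣shiftL∣ : ∀ N c → ∣ shiftL N c ∣ ≡ ∣ c ∣ + N
∣shiftL∣ N (+ k)    = refl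
∣shiftL∣ N -[1+ k ] = refl

isNeg-shiftL : ∀ N c → isNeg (shiftL N c) ≡ isNeg c
isNeg-shiftL N (+ k)    = refl
isNeg-shiftL N -[1+ k ] = refl

withSign-shiftL : ∀ N m r c → NonZero c → withSign (shiftL N c) (suc (m + r)) ≡ shiftL m (withSign c (suc r))
withSign-shiftL N m r +[1+ k ] _ = cong (λ n → + suc n) (ℕ.+-comm m r)
withSign-shiftL N m r -[1+ k ] _ = cong -[1+_] (ℕ.+-comm m r)

countSmaller-++ : ∀ a X Y → countSmaller a (X ++ Y) ≡ countSmaller a X + countSmaller a Y
countSmaller-++ a []      Y = refl
countSmaller-++ a (c ∷ X) Y = trans (cong (_+_ _) (countSmaller-++ a X Y)) (sym (ℕ.+-assoc (if ∣ c ∣ <ᵇ ∣ a ∣ then 1 else 0) _ _))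

countSmaller-none : ∀ a L → All (λ c → ∣ a ∣ ≤ ∣ c ∣) L → countSmaller a L ≡ 0
countSmaller-none a []      []       = refl
countSmaller-none a (c ∷ L) (a≤c ∷ h) rewrite <ᵇ-false {∣ c ∣} {∣ a ∣} a≤c = countSmaller-none a L h

countSmaller-all : ∀ a L → All (λ c → ∣ c ∣ < ∣ a ∣) L → countSmaller a L ≡ length L
countSmaller-all a []      []       = refl
countSmaller-all a (c ∷ L) (c<a ∷ h) rewrite <ᵇ-true c<a = cong suc (countSmaller-all a L h)

countSmaller-shift : ∀ N c τ → countSmaller (shiftL N c) (shift N τ) ≡ countSmaller c τ
countSmaller-shift N c []      = refl
countSmaller-shift N c (d ∷ τ) rewrite ∣shiftL∣ N c | ∣shiftL∣ N d =
  cong₂ _+_ (cong (λ b → if b then 1 else 0) (<ᵇ-+ ∣ d ∣ ∣ c ∣)) (countSmaller-shift N c τ)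
  where
  <ᵇ-+ : ∀ x y → ((x + N) <ᵇ (y + N)) ≡ (x <ᵇ y)
  <ᵇ-+ x y = T-ext (λ t → ℕ.<⇒<ᵇ (ℕ.+-cancelʳ-< N x y (ℕ.<ᵇ⇒< (x + N) (y + N) t)))
                   (λ t → ℕ.<⇒<ᵇ (ℕ.+-monoˡ-< N (ℕ.<ᵇ⇒< x y t)))

linear-weight-standardize : ∀ w N σ τ → Distinct σ → Distinct τ → All (λ a → ∣ a ∣ ≤ N) σ
  → linear (weight w) (σ ⋆ shift N τ) ≡ linear (weight w) (st σ ⋆ shift (length σ) (st τ))
linear-weight-standardize w N σ τ (_ , σ-unique) (τ≠0 , τ-unique) σ≤N = begin
  linear (weight w) (σ ⋆ shift N τ)
    ≡⟨ linear-cong (σ ⋆ shift N τ) (All.map weight-relabel (⋆-⊆ σ (shift N τ))) ⟨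
  linear (weight w ∘ map f) (σ ⋆ shift N τ)
    ≡⟨ linear-relabel (weight w) f (σ ⋆ shift N τ) ⟨
  linear (weight w) (relabel f (σ ⋆ shift N τ))
    ≡⟨ cong (linear (weight w)) (⋆-relabel f f-sign σ (shift N τ)) ⟨
  linear (weight w) (map f σ ⋆ map f (shift N τ))
    ≡⟨ cong₂ (λ A B → linear (weight w) (A ⋆ B)) rank-σ rank-τ ⟩
  linear (weight w) (st σ ⋆ shift (length σ) (st τ)) ∎
  where
  Z = σ ++ shift N τ
  f = rank Z
  f-sign : ∀ a → isNeg (f a) ≡ isNeg a
  f-sign a = isNeg-withSign a (countSmaller a Z)
  weight-relabel : ∀ {t} → t ⊆ Z → weight w (map f t) ≡ weight w t
  weight-relabel {t} t⊆Z = cong (λ s → coeff (φ₂ s) w)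
    (st-relabel f t f-sign (λ a∈ b∈ → rank-preservesAbsOrder Z (t⊆Z a∈) (t⊆Z b∈)))
  N<τ : ∀ {c} → c ∈ τ → N < ∣ shiftL N c ∣
  N<τ {c} c∈ = subst (N <_) (sym (∣shiftL∣ N c)) (ℕ.m<n+m N (ℕ.>-nonZero⁻¹ ∣ c ∣ {{All.lookup τ≠0 c∈}}))
  rank-σ : map f σ ≡ st σ
  rank-σ = trans (map-cong-local (All.tabulate λ {a} a∈ → cong (λ r → withSign a (suc r)) (begin
      countSmaller a Z                                   ≡⟨ countSmaller-++ a σ (shift N τ) ⟩
      countSmaller a σ + countSmaller a (shift N τ)      ≡⟨ cong (_+_ _) (countSmaller-none a (shift N τ)
                                                              (All.map⁺ (All.tabulate λ c∈ → ℕ.<⇒≤ (ℕ.≤-<-trans (All.lookup σ≤N a∈) (N<τ c∈))))) ⟩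
      countSmaller a σ + 0                               ≡⟨ ℕ.+-identityʳ _ ⟩
      countSmaller a σ ∎)))
    (sym (st≡map-rank σ σ-unique))
  rank-τ : map f (shift N τ) ≡ shift (length σ) (st τ)
  rank-τ = begin
    map f (map (shiftL N) τ)                      ≡⟨ map-∘ τ ⟨
    map (f ∘ shiftL N) τ                          ≡⟨ map-cong-local (All.tabulate shifted) ⟩
    map (shiftL (length σ) ∘ rank τ) τ            ≡⟨ map-∘ τ ⟩
    map (shiftL (length σ)) (map (rank τ) τ)      ≡⟨ cong (shift (length σ)) (st≡map-rank τ τ-unique) ⟨
    shift (length σ) (st τ) ∎
    where
    shifted : ∀ {c} → c ∈ τ → f (shiftL N c) ≡ shiftL (length σ) (rank τ c)
    shifted {c} c∈ = trans (cong (λ r → withSign (shiftL N c) (suc r)) (begin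
        countSmaller (shiftL N c) Z
          ≡⟨ countSmaller-++ (shiftL N c) σ (shift N τ) ⟩
        countSmaller (shiftL N c) σ + countSmaller (shiftL N c) (shift N τ)
          ≡⟨ cong₂ _+_ (countSmaller-all _ σ (All.map (λ a≤N → ℕ.≤-<-trans a≤N (N<τ c∈)) σ≤N)) (countSmaller-shift N c τ) ⟩
        length σ + countSmaller c τ ∎))
      (withSign-shiftL N (length σ) (countSmaller c τ) c (All.lookup τ≠0 c∈))

Distinct-++⁻ʳ : ∀ P {σ} → Distinct (P ++ σ) → Distinct σ
Distinct-++⁻ʳ []      d = d
Distinct-++⁻ʳ (_ ∷ P) d = Distinct-++⁻ʳ P (Distinct-tail d)

NonZero-shiftL : ∀ N c → NonZero c → NonZero (shiftL N c)
NonZero-shiftL N +[1+ k ] _ = _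
NonZero-shiftL N -[1+ k ] _ = _

Distinct-shift : ∀ N {u} → Distinct u → Distinct (shift N u)
Distinct-shift N {u} (u≠0 , unique) =
  All.map⁺ (All.map (λ {c} → NonZero-shiftL N c) u≠0) ,
  subst Unique (trans (sym (map-∘ u)) (trans (map-cong (λ c → sym (∣shiftL∣ N c)) u) (map-∘ u)))
    (Unique.map⁺ (ℕ.+-cancelʳ-≡ N _ _) unique)

shift-disjoint : ∀ N {X Y} → All (λ a → ∣ a ∣ ≤ N) X → All NonZero Y → Disjoint (map ∣_∣ X) (map ∣_∣ (shift N Y))
shift-disjoint N X≤N Y≠0 (v∈X , v∈Y) with ∈-map⁻ ∣_∣ v∈X | ∈-map⁻ ∣_∣ v∈Y
... | a , a∈ , refl | c′ , c′∈ , eq with ∈-map⁻ (shiftL N) c′∈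
...   | c , c∈ , refl = ℕ.<⇒≱ N<c (ℕ.≤-trans (ℕ.≤-reflexive (trans (sym (∣shiftL∣ N c)) (sym eq))) (All.lookup X≤N a∈))
  where
  N<c : N < ∣ c ∣ + N
  N<c = ℕ.m<n+m N (ℕ.>-nonZero⁻¹ ∣ c ∣ {{All.lookup Y≠0 c∈}})

linear-weight-split : ∀ w N P σ Q τ → All IsNeg P → All IsNeg Q → FirstPos σ → FirstPos τ
  → Distinct (P ++ σ) → Distinct (Q ++ τ) → All (λ a → ∣ a ∣ ≤ N) (P ++ σ)
  → linear (weight w) ((P ++ σ) ⋆ shift N (Q ++ τ)) ≡ linear (weight w) (st σ ⋆ shift (length σ) (st τ))
linear-weight-split w N P σ@(+[1+ ka ] ∷ x) Q τ@(+[1+ kb ] ∷ y) P<0 Q<0 _ _ dPσ dQτ Pσ≤N = begin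
  linear (weight w) ((P ++ σ) ⋆ shift N (Q ++ τ))
    ≡⟨ cong (λ V → linear (weight w) ((P ++ σ) ⋆ V)) (map-++ (shiftL N) Q τ) ⟩
  linear (weight w) ((P ++ σ) ⋆ (shift N Q ++ shift N τ))
    ≡⟨ NegativePrefixes.linear-⋆-negPrefixes (weight w) (weight-dropNeg w) (weight-posNegPos w)
         ka x (kb + N) (shift N y) P (shift N Q) P<0 Q[N]<0 dPσ dQτ[N] disjoint ⟩
  linear (weight w) (σ ⋆ shift N τ)
    ≡⟨ linear-weight-standardize w N σ τ (Distinct-++⁻ʳ P dPσ) (Distinct-++⁻ʳ Q dQτ) (All.++⁻ʳ P Pσ≤N) ⟩
  linear (weight w) (st σ ⋆ shift (length σ) (st τ)) ∎
  where
  Q[N]<0 : All IsNeg (shift N Q)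
  Q[N]<0 = All.map⁺ (All.map (λ {c} → subst T (sym (isNeg-shiftL N c))) Q<0)
  dQτ[N] : Distinct (shift N Q ++ shift N τ)
  dQτ[N] = subst Distinct (map-++ (shiftL N) Q τ) (Distinct-shift N dQτ)
  disjoint : Disjoint (map ∣_∣ (P ++ σ)) (map ∣_∣ (shift N Q ++ shift N τ))
  disjoint = subst (λ V → Disjoint (map ∣_∣ (P ++ σ)) (map ∣_∣ V)) (map-++ (shiftL N) Q τ)
    (shift-disjoint N Pσ≤N (proj₁ dQτ))

signedPerm-∣∣ : ∀ {N α} → IsSignedPerm N α → ∀ {a} → a ∈ α → ∃₂ λ k (_ : k < N) → ∣ a ∣ ≡ suc k
signedPerm-∣∣ α-perm a∈ with ∈-map⁻ suc (∈-resp-↭ α-perm (∈-map⁺ ∣_∣ a∈))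
... | k , k∈ , eq = k , ∈-upTo⁻ k∈ , eq

signedPerm-length : ∀ N {α} → IsSignedPerm N α → length α ≡ N
signedPerm-length N {α} α-perm =
  trans (sym (length-map ∣_∣ α)) (trans (↭-length α-perm) (trans (length-map suc (upTo N)) (length-upTo N)))

signedPerm-Distinct : ∀ N {α} → IsSignedPerm N α → Distinct α
signedPerm-Distinct N α-perm =
  All.tabulate (λ a∈ → let (_ , _ , eq) = signedPerm-∣∣ α-perm a∈ in subst ℕ.NonZero (sym eq) _) ,
  Unique-resp-↭ (↭⇒↭ₛ (↭-sym α-perm)) (Unique.map⁺ ℕ.suc-injective (Unique.upTo⁺ N))

signedPerm-bounded : ∀ N {α} → IsSignedPerm N α → All (λ a → ∣ a ∣ ≤ N) α
signedPerm-bounded N α-perm = All.tabulate λ a∈ → let (_ , k<N , eq) = signedPerm-∣∣ α-perm a∈ in subst (_≤ N) (sym eq) k<N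

lemma4p8 : (i j m n : ℕ) → m ≥ 1 → n ≥ 1 → (α β : List ℤ)
           → IsSignedPerm (i + m) α → IsSignedPerm (j + n) β
           → All (λ a → T (isNeg a)) (take i α) → All (λ b → T (isNeg b)) (take j β)
           → FirstPos (drop i α) → FirstPos (drop j β)
           → (w : List ℤ)
           → coeff (φ₂L (α ⋆̄ β)) w ≡ coeff (φ₂L (st (drop i α) ⋆̄ st (drop j β))) w
lemma4p8 i j m n _ _ α β α-perm β-perm P<0 Q<0 σ-pos τ-pos w = begin
  coeff (φ₂L (α ⋆̄ β)) w
    ≡⟨ coeff-φ₂L-⋆̄ α β w ⟩
  linear (weight w) (α ⋆ shift (length α) β)
    ≡⟨ cong₂ (λ A B → linear (weight w) (A ⋆ shift (length α) B)) (take++drop≡id i α) (take++drop≡id j β) ⟨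
  linear (weight w) ((take i α ++ σ) ⋆ shift (length α) (take j β ++ τ))
    ≡⟨ linear-weight-split w (length α) (take i α) σ (take j β) τ P<0 Q<0 σ-pos τ-pos
         (split Distinct i α (signedPerm-Distinct _ α-perm)) (split Distinct j β (signedPerm-Distinct _ β-perm))
         (split (All (λ a → ∣ a ∣ ≤ length α)) i α α-bounded) ⟩
  linear (weight w) (st σ ⋆ shift (length σ) (st τ))
    ≡⟨ cong (λ k → linear (weight w) (st σ ⋆ shift k (st τ))) (length-st σ) ⟨
  linear (weight w) (st σ ⋆ shift (length (st σ)) (st τ))
    ≡⟨ coeff-φ₂L-⋆̄ (st σ) (st τ) w ⟨
  coeff (φ₂L (st σ ⋆̄ st τ)) w ∎
  where
  σ = drop i α
  τ = drop j β
  split : ∀ (P : List ℤ → Set) k γ → P γ → P (take k γ ++ drop k γ)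
  split P k γ = subst P (sym (take++drop≡id k γ))
  α-bounded : All (λ a → ∣ a ∣ ≤ length α) α
  α-bounded = subst (λ N → All (λ a → ∣ a ∣ ≤ N) α) (sym (signedPerm-length _ α-perm)) (signedPerm-bounded _ α-perm)
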